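{- Let $T$ be a tree, $v$ a leaf of $T$ with neighbor $w$, and $T'=T\setminus v$. Let $n_l$ (resp. $n_i$) be the number of neighbors of $w$ that are leaves (resp. inner nodes). If $n_l>n_i+1$, then $|E_{pure}(T)|=|E_{pure}(T')|$.
   Context: For a tree $T=(V,E)$, $E_{pure}(T)$ is the set of all $F\subseteq E$ with $2deg_F(u)<deg(u)$ for every $u\in V$, where $deg_F(u)$ is the number of edges of $F$ incident to $u$ and $deg(u)$ is the degree of $u$ in $T$. $T\setminus v$ is the tree obtained by deleting the leaf $v$ and its incident edge. -}

module Defs where

open import Data.Nat using (ℕ; zero; suc; _*_; _<_; _≤_; _+_)
open import Data.Nat.Properties using () renaming (_≟_ to _≟ℕ_)
open import Data.Nat.Properties using (_<?_)
open import Data.Fin using (Fin; zero; suc; punchOut; punchIn; _≟_)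
open import Data.Fin.Properties using (all?; any?)
open import Data.Fin.Subset using (Subset; _∈_)
open import Data.Fin.Subset.Properties using (_∈?_)
open import Data.Vec using (_∷_; [])
open import Data.Bool using (true; false)
open import Data.List using (List; []; _∷_; _++_; map; length; filter; allFin)
open import Data.Product using (_×_; _,_; proj₁; proj₂; ∃)
open import Data.Product.Properties using (≡-dec)
open import Data.Sum using (_⊎_)
open import Relation.Nullary using (¬_; yes; no; ¬?)
open import Relation.Nullary.Decidable using (_×-dec_; _⊎-dec_)
open import Relation.Binary.PropositionalEquality using (_≡_; _≢_)

-- A (multi)graph with vertex set Fin n and edge set Fin m; edge e joins
-- proj₁ (E e) and proj₂ (E e).
EdgeMap : ℕ → ℕ → Set
EdgeMap n m = Fin m → Fin n × Fin n

module _ {n m : ℕ} (E : EdgeMap n m) where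

  Incident : Fin n → Fin m → Set
  Incident u e = u ≡ proj₁ (E e) ⊎ u ≡ proj₂ (E e)

  incident? : (u : Fin n) (e : Fin m) → _
  incident? u e = (u ≟ proj₁ (E e)) ⊎-dec (u ≟ proj₂ (E e))

  degIn : Subset m → Fin n → ℕ
  degIn F u = length (filter (λ e → (e ∈? F) ×-dec incident? u e) (allFin m))

  deg : Fin n → ℕ
  deg u = length (filter (incident? u) (allFin m))

  SameEnds : Fin m → Fin m → Set
  SameEnds e e' = E e ≡ E e' ⊎ (proj₁ (E e) ≡ proj₂ (E e') × proj₂ (E e) ≡ proj₁ (E e'))

  Simple : Set
  Simple = (∀ e → proj₁ (E e) ≢ proj₂ (E e)) × (∀ e e' → SameEnds e e' → e ≡ e')

  Adjacent : Fin n → Fin n → Set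
  Adjacent x y = ∃ λ e → (E e ≡ (x , y)) ⊎ (E e ≡ (y , x))

  _≟E_ : (p q : Fin n × Fin n) → _
  _≟E_ = ≡-dec _≟_ _≟_

  adjacent? : (x y : Fin n) → _
  adjacent? x y = any? (λ e → (E e ≟E (x , y)) ⊎-dec (E e ≟E (y , x)))

  data Walk : Fin n → Fin n → Set where
    here : ∀ {x} → Walk x x
    step : ∀ {x y z} → Adjacent x y → Walk y z → Walk x z

  Connected : Set
  Connected = ∀ x y → Walk x y

  IsTree : Set
  IsTree = Simple × Connected × (suc m ≡ n)

  IsLeaf : Fin n → Set
  IsLeaf x = deg x ≡ 1

  IsInner : Fin n → Set
  IsInner x = ¬ (deg x ≡ 1)

  nLeafNbrs : Fin n → ℕ
  nLeafNbrs w = length (filter (λ x → adjacent? x w ×-dec (deg x ≟ℕ 1)) (allFin n))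

  nInnerNbrs : Fin n → ℕ
  nInnerNbrs w = length (filter (λ x → adjacent? x w ×-dec ¬? (deg x ≟ℕ 1)) (allFin n))

  IsPure : Subset m → Set
  IsPure F = ∀ u → 2 * degIn F u < deg u

  isPure? : (F : Subset m) → _
  isPure? F = all? (λ u → (2 * degIn F u) <? deg u)

allSubsets : ∀ m → List (Subset m)
allSubsets zero = [] ∷ []
allSubsets (suc m) = map (true ∷_) (allSubsets m) ++ map (false ∷_) (allSubsets m)

numPure : ∀ {n m} → EdgeMap n m → ℕ
numPure {m = m} E = length (filter (isPure? E) (allSubsets m))

-- vertex relabelling after deleting v (value at v itself is irrelevant junk)
delV : ∀ {k} → Fin (suc (suc k)) → Fin (suc (suc k)) → Fin (suc k)
delV v x with v ≟ x
... | yes _ = zero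
... | no p = punchOut p

-- T \ v : delete vertex v and edge e0 (the edge incident to v)
delLeaf : ∀ {k m} → EdgeMap (suc (suc k)) (suc m) → Fin (suc (suc k)) → Fin (suc m)
        → EdgeMap (suc k) m
delLeaf E v e0 i = delV v (proj₁ (E (punchIn e0 i))) , delV v (proj₂ (E (punchIn e0 i)))

-- Since deg v = 1, purity at v forbids the edge e₀ = vw, so every pure set of T is an edge set of
-- T′, and deleting v lowers the degree of w by one while leaving the other degrees unchanged.
-- Purity thus transfers in both directions unless its condition is tight at w, which it never is:
-- a pure F contains no edge at a leaf, so deg_F(w) ≤ n_i, while in a simple graph
-- deg(w) = n_l + n_i, and n_l > n_i + 1 gives 2 deg_F(w) + 2 ≤ deg(w).

module Submission where

open import Defs
open import Level using (0ℓ)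
open import Function using (_∘_)
open import Data.Bool using (Bool; true; false; if_then_else_)
open import Data.Nat using (ℕ; zero; suc; _+_; _*_; _≤_; _<_; _>_; z≤n; s≤s; s≤s⁻¹) renaming (_≟_ to _≟ℕ_)
open import Data.Nat.Properties
  using (≤-antisym; ≤-trans; m≤n⇒m≤1+n; m<n⇒m<1+n; +-suc; +-comm; +-identityʳ; +-mono-≤;
         +-commutativeSemigroup; 0≢1+n; suc-injective; module ≤-Reasoning)
open import Algebra.Properties.CommutativeSemigroup +-commutativeSemigroup using (x∙yz≈y∙xz)
open import Data.Fin using (Fin; zero; suc; punchIn; _≟_)
open import Data.Fin.Properties using (punchInᵢ≢i; punchOut-punchIn; punchOut-cong; punchOut-injective)
  renaming (0≢1+n to zero≢suc; suc-injective to Fin-suc-injective)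
open import Data.Fin.Subset using (Subset; _∈_)
open import Data.Fin.Subset.Properties using (_∈?_)
open import Data.Vec using (lookup; insertAt) renaming (_∷_ to _∷ᵥ_)
open import Data.Vec.Properties using (insertAt-punchIn; insertAt-lookup; []=⇒lookup; lookup⇒[]=)
open import Data.List using (List; []; _∷_; _++_; map; length; filter; allFin; tabulate)
open import Data.List.Properties using (filter-++; length-++; filter-none; filter-≐)
import Data.List.Relation.Unary.All as All
open import Data.Product using (_×_; _,_; proj₁; proj₂)
open import Data.Sum using (_⊎_; inj₁; inj₂; [_,_]; swap)
open import Relation.Nullary using (¬_; Dec; yes; no; does; contradiction)
open import Relation.Nullary.Decidable using (dec-true; dec-false; _×-dec_)
open import Relation.Unary using (Pred; Decidable; _⊆_; _≐_)
open import Relation.Unary.Properties using (_∩?_; ∁?)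
open import Relation.Binary.PropositionalEquality
  using (_≡_; _≢_; refl; sym; trans; cong; cong₂; subst; subst₂; module ≡-Reasoning)

indicator : {P : Set} → Dec P → ℕ
indicator P? = if does P? then 1 else 0

indicator-yes : {P : Set} (P? : Dec P) → P → indicator P? ≡ 1
indicator-yes P? p = cong (if_then 1 else 0) (dec-true P? p)

indicator-no : {P : Set} (P? : Dec P) → ¬ P → indicator P? ≡ 0
indicator-no P? ¬p = cong (if_then 1 else 0) (dec-false P? ¬p)

count : ∀ {n} {P : Pred (Fin n) 0ℓ} → Decidable P → ℕ
count {zero}  P? = 0
count {suc n} P? = indicator (P? zero) + count (P? ∘ suc)

length-filter-tabulate : ∀ {A : Set} {n} {P : Pred A 0ℓ} (P? : Decidable P) (f : Fin n → A) →
                         length (filter P? (tabulate f)) ≡ count (P? ∘ f)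
length-filter-tabulate {n = zero}  P? f = refl
length-filter-tabulate {n = suc n} P? f with does (P? (f zero))
... | true  = cong suc (length-filter-tabulate P? (f ∘ suc))
... | false = length-filter-tabulate P? (f ∘ suc)

length-filter-allFin : ∀ {n} {P : Pred (Fin n) 0ℓ} (P? : Decidable P) →
                       length (filter P? (allFin n)) ≡ count P?
length-filter-allFin P? = length-filter-tabulate P? (λ i → i)

count-mono : ∀ {n} {P Q : Pred (Fin n) 0ℓ} (P? : Decidable P) (Q? : Decidable Q) →
             P ⊆ Q → count P? ≤ count Q?
count-mono {zero}  P? Q? P⊆Q = z≤n
count-mono {suc n} P? Q? P⊆Q with P? zero | Q? zero | count-mono (P? ∘ suc) (Q? ∘ suc) P⊆Q
... | yes _ | yes _  | ih = s≤s ih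
... | yes p | no ¬q  | _  = contradiction (P⊆Q p) ¬q
... | no _  | yes _  | ih = m≤n⇒m≤1+n ih
... | no _  | no _   | ih = ih

count-cong : ∀ {n} {P Q : Pred (Fin n) 0ℓ} (P? : Decidable P) (Q? : Decidable Q) →
             P ≐ Q → count P? ≡ count Q?
count-cong P? Q? (P⊆Q , Q⊆P) = ≤-antisym (count-mono P? Q? P⊆Q) (count-mono Q? P? Q⊆P)

count-punchIn : ∀ {n} {P : Pred (Fin (suc n)) 0ℓ} (P? : Decidable P) (i : Fin (suc n)) →
                count P? ≡ indicator (P? i) + count (P? ∘ punchIn i)
count-punchIn         P? zero    = refl
count-punchIn {suc n} P? (suc i) = begin
  indicator (P? zero) + count (P? ∘ suc)
    ≡⟨ cong (indicator (P? zero) +_) (count-punchIn (P? ∘ suc) i) ⟩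
  indicator (P? zero) + (indicator (P? (suc i)) + count (P? ∘ suc ∘ punchIn i))
    ≡⟨ x∙yz≈y∙xz (indicator (P? zero)) (indicator (P? (suc i))) _ ⟩
  indicator (P? (suc i)) + (indicator (P? zero) + count (P? ∘ suc ∘ punchIn i)) ∎
  where open ≡-Reasoning

count-remove : ∀ {n} {P : Pred (Fin n) 0ℓ} (P? : Decidable P) {i : Fin n} →
               P i → count P? ≡ suc (count (P? ∩? ∁? (_≟ i)))
count-remove {suc n} P? {i} p = begin
  count P?                                   ≡⟨ count-punchIn P? i ⟩
  indicator (P? i) + count (P? ∘ punchIn i)  ≡⟨ cong (_+ count (P? ∘ punchIn i)) (indicator-yes (P? i) p) ⟩
  suc (count (P? ∘ punchIn i))               ≡⟨ cong suc (count-cong (P? ∘ punchIn i) (P?∖i ∘ punchIn i)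
                                                  ((λ q → q , punchInᵢ≢i i _) , proj₁)) ⟩
  suc (count (P?∖i ∘ punchIn i))             ≡⟨ cong (λ c → suc (c + count (P?∖i ∘ punchIn i)))
                                                  (sym (indicator-no (P?∖i i) (λ q → proj₂ q refl))) ⟩
  suc (indicator (P?∖i i) + count (P?∖i ∘ punchIn i)) ≡⟨ cong suc (sym (count-punchIn P?∖i i)) ⟩
  suc (count P?∖i)                           ∎
  where
  open ≡-Reasoning
  P?∖i = P? ∩? ∁? (_≟ i)

count≡0⇒∁ : ∀ {n} {P : Pred (Fin n) 0ℓ} (P? : Decidable P) → count P? ≡ 0 → ∀ x → ¬ P x
count≡0⇒∁ P? none x p = 0≢1+n (trans (sym none) (count-remove P? p))

count-none : ∀ {n} {P : Pred (Fin n) 0ℓ} (P? : Decidable P) → (∀ x → ¬ P x) → count P? ≡ 0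
count-none {zero}  P? none = refl
count-none {suc n} P? none =
  cong₂ _+_ (indicator-no (P? zero) (none zero)) (count-none (P? ∘ suc) (none ∘ suc))

count-split : ∀ {n} {P Q : Pred (Fin n) 0ℓ} (P? : Decidable P) (Q? : Decidable Q) →
              count P? ≡ count (P? ∩? Q?) + count (P? ∩? ∁? Q?)
count-split {zero}  P? Q? = refl
count-split {suc n} P? Q? with P? zero | Q? zero | count-split (P? ∘ suc) (Q? ∘ suc)
... | yes _ | yes _ | ih = cong suc ih
... | yes _ | no _  | ih = trans (cong suc ih) (sym (+-suc _ _))
... | no _  | _     | ih = ih

count-≤-injection : ∀ {a b} {P : Pred (Fin a) 0ℓ} {Q : Pred (Fin b) 0ℓ}
                    (P? : Decidable P) (Q? : Decidable Q) (f : ∀ {x} → P x → Fin b) →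
                    (∀ {x} (px : P x) → Q (f px)) →
                    (∀ {x y} (px : P x) (py : P y) → f px ≡ f py → x ≡ y) →
                    count P? ≤ count Q?
count-≤-injection {zero}  P? Q? f f∈Q f-inj = z≤n
count-≤-injection {suc a} P? Q? f f∈Q f-inj with P? zero
... | no _  = count-≤-injection (P? ∘ suc) Q? f f∈Q (λ px py → Fin-suc-injective ∘ f-inj px py)
... | yes p = begin
  suc (count (P? ∘ suc))             ≤⟨ s≤s (count-≤-injection (P? ∘ suc) (Q? ∩? ∁? (_≟ f p)) f
                                          (λ px → f∈Q px , zero≢suc ∘ f-inj p px ∘ sym)
                                          (λ px py → Fin-suc-injective ∘ f-inj px py)) ⟩
  suc (count (Q? ∩? ∁? (_≟ f p)))    ≡⟨ sym (count-remove Q? (f∈Q p)) ⟩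
  count Q?                           ∎
  where open ≤-Reasoning

length-filter-map : ∀ {A B : Set} {P : Pred B 0ℓ} (P? : Decidable P) (f : A → B) (xs : List A) →
                    length (filter P? (map f xs)) ≡ length (filter (P? ∘ f) xs)
length-filter-map P? f []       = refl
length-filter-map P? f (x ∷ xs) with does (P? (f x))
... | true  = cong suc (length-filter-map P? f xs)
... | false = length-filter-map P? f xs

length-filter-allSubsets : ∀ {m} {P : Pred (Subset (suc m)) 0ℓ} (P? : Decidable P) →
                           length (filter P? (allSubsets (suc m)))
                             ≡ length (filter (P? ∘ (true ∷ᵥ_)) (allSubsets m))
                               + length (filter (P? ∘ (false ∷ᵥ_)) (allSubsets m))
length-filter-allSubsets {m} P? = begin
  length (filter P? (map (true ∷ᵥ_) Fs ++ map (false ∷ᵥ_) Fs))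
    ≡⟨ cong length (filter-++ P? (map (true ∷ᵥ_) Fs) _) ⟩
  length (filter P? (map (true ∷ᵥ_) Fs) ++ filter P? (map (false ∷ᵥ_) Fs))
    ≡⟨ length-++ (filter P? (map (true ∷ᵥ_) Fs)) ⟩
  length (filter P? (map (true ∷ᵥ_) Fs)) + length (filter P? (map (false ∷ᵥ_) Fs))
    ≡⟨ cong₂ _+_ (length-filter-map P? (true ∷ᵥ_) Fs) (length-filter-map P? (false ∷ᵥ_) Fs) ⟩
  length (filter (P? ∘ (true ∷ᵥ_)) Fs) + length (filter (P? ∘ (false ∷ᵥ_)) Fs) ∎
  where
  open ≡-Reasoning
  Fs = allSubsets m

length-filter-allSubsets-insertAt :
  ∀ {m} {P : Pred (Subset (suc m)) 0ℓ} (P? : Decidable P) (i : Fin (suc m)) →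
  (∀ F → P F → lookup F i ≡ false) →
  length (filter P? (allSubsets (suc m)))
    ≡ length (filter (λ F → P? (insertAt F i false)) (allSubsets m))
length-filter-allSubsets-insertAt {m} P? zero i∉P = begin
  length (filter P? (allSubsets (suc m)))  ≡⟨ length-filter-allSubsets P? ⟩
  length (filter (P? ∘ (true ∷ᵥ_)) Fs) + length (filter (P? ∘ (false ∷ᵥ_)) Fs)
    ≡⟨ cong (λ xs → length xs + length (filter (P? ∘ (false ∷ᵥ_)) Fs))
            (filter-none (P? ∘ (true ∷ᵥ_)) (All.universal (λ F → true≢false ∘ i∉P (true ∷ᵥ F)) Fs)) ⟩
  length (filter (P? ∘ (false ∷ᵥ_)) Fs) ∎
  where
  open ≡-Reasoning
  Fs = allSubsets m
  true≢false : true ≢ false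
  true≢false ()
length-filter-allSubsets-insertAt {suc m} P? (suc i) i∉P = begin
  length (filter P? (allSubsets (suc (suc m))))
    ≡⟨ length-filter-allSubsets P? ⟩
  length (filter (P? ∘ (true ∷ᵥ_)) (allSubsets (suc m)))
    + length (filter (P? ∘ (false ∷ᵥ_)) (allSubsets (suc m)))
    ≡⟨ cong₂ _+_ (length-filter-allSubsets-insertAt (P? ∘ (true ∷ᵥ_)) i (i∉P ∘ (true ∷ᵥ_)))
                 (length-filter-allSubsets-insertAt (P? ∘ (false ∷ᵥ_)) i (i∉P ∘ (false ∷ᵥ_))) ⟩
  length (filter (λ F → P? (true ∷ᵥ insertAt F i false)) (allSubsets m))
    + length (filter (λ F → P? (false ∷ᵥ insertAt F i false)) (allSubsets m))
    ≡⟨ length-filter-allSubsets (λ F → P? (insertAt F (suc i) false)) ⟨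
  length (filter (λ F → P? (insertAt F (suc i) false)) (allSubsets (suc m))) ∎
  where open ≡-Reasoning

opposite : ∀ {n} → Fin n → Fin n × Fin n → Fin n
opposite w (a , b) with a ≟ w
... | yes _ = b
... | no _  = a

opposite-≡ : ∀ {n} {w x : Fin n} {p} → p ≡ (x , w) ⊎ p ≡ (w , x) → opposite w p ≡ x
opposite-≡ {w = w} {x} (inj₁ refl) with x ≟ w
... | yes x≡w = sym x≡w
... | no _    = refl
opposite-≡ {w = w} (inj₂ refl) with w ≟ w
... | yes _   = refl
... | no w≢w  = contradiction refl w≢w

opposite-spec : ∀ {n} {w : Fin n} p → w ≡ proj₁ p ⊎ w ≡ proj₂ p →
                p ≡ (opposite w p , w) ⊎ p ≡ (w , opposite w p)
opposite-spec {w = w} (a , b) w∈p with a ≟ w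
opposite-spec (a , b) w∈p          | yes refl = inj₂ refl
opposite-spec (a , b) (inj₁ w≡a)   | no a≢w   = contradiction (sym w≡a) a≢w
opposite-spec (a , b) (inj₂ refl)  | no _     = inj₁ refl

2*d<1⇒d≡0 : ∀ {d} → 2 * d < 1 → d ≡ 0
2*d<1⇒d≡0 {zero}  _ = refl
2*d<1⇒d≡0 {suc d} (s≤s ())

d≤i⇒i+1<l⇒2+2*d≤l+i : ∀ {d i l} → d ≤ i → i + 1 < l → 2 + 2 * d ≤ l + i
d≤i⇒i+1<l⇒2+2*d≤l+i {d} {i} {l} d≤i i+1<l = +-mono-≤ 2+d≤l (subst (_≤ i) (sym (+-identityʳ d)) d≤i)
  where
  2+d≤l : 2 + d ≤ l
  2+d≤l = ≤-trans (s≤s (s≤s d≤i)) (subst (_≤ l) (cong suc (+-comm i 1)) i+1<l)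

module _ {n m : ℕ} (E : EdgeMap n m) where

  Joins : Fin m → Fin n → Fin n → Set
  Joins e x y = E e ≡ (x , y) ⊎ E e ≡ (y , x)

  deg≡count : ∀ u → deg E u ≡ count (incident? E u)
  deg≡count u = length-filter-allFin (incident? E u)

  degIn≡count : ∀ F u → degIn E F u ≡ count ((_∈? F) ∩? incident? E u)
  degIn≡count F u = length-filter-allFin ((_∈? F) ∩? incident? E u)

  joins⇒incident : ∀ {e x y} → Joins e x y → Incident E x e
  joins⇒incident (inj₁ eq) = inj₁ (sym (cong proj₁ eq))
  joins⇒incident (inj₂ eq) = inj₂ (sym (cong proj₂ eq))

  joins-incident : ∀ {e x y u} → Joins e x y → Incident E u e → u ≡ x ⊎ u ≡ y
  joins-incident (inj₁ eq) (inj₁ u≡) = inj₁ (trans u≡ (cong proj₁ eq))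
  joins-incident (inj₁ eq) (inj₂ u≡) = inj₂ (trans u≡ (cong proj₂ eq))
  joins-incident (inj₂ eq) (inj₁ u≡) = inj₂ (trans u≡ (cong proj₁ eq))
  joins-incident (inj₂ eq) (inj₂ u≡) = inj₁ (trans u≡ (cong proj₂ eq))

  joins⇒≢ : Simple E → ∀ {e x y} → Joins e x y → x ≢ y
  joins⇒≢ (no-loops , _) {e} (inj₁ eq) refl = no-loops e (trans (cong proj₁ eq) (sym (cong proj₂ eq)))
  joins⇒≢ (no-loops , _) {e} (inj₂ eq) refl = no-loops e (trans (cong proj₁ eq) (sym (cong proj₂ eq)))

  joins-sameEnds : ∀ {e e′ x y} → Joins e x y → Joins e′ x y → SameEnds E e e′
  joins-sameEnds = sameEnds
    where
    sameEnds : ∀ {x y} {p q : Fin n × Fin n} → p ≡ (x , y) ⊎ p ≡ (y , x) → q ≡ (x , y) ⊎ q ≡ (y , x) →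
               p ≡ q ⊎ (proj₁ p ≡ proj₂ q × proj₂ p ≡ proj₁ q)
    sameEnds (inj₁ refl) (inj₁ refl) = inj₁ refl
    sameEnds (inj₁ refl) (inj₂ refl) = inj₂ (refl , refl)
    sameEnds (inj₂ refl) (inj₁ refl) = inj₂ (refl , refl)
    sameEnds (inj₂ refl) (inj₂ refl) = inj₁ refl

  incident⇒joins-opposite : ∀ {w e} → Incident E w e → Joins e (opposite w (E e)) w
  incident⇒joins-opposite {e = e} = opposite-spec (E e)

  leaf? : Decidable (IsLeaf E)
  leaf? x = deg E x ≟ℕ 1

  #neighbours : Fin n → {Q : Pred (Fin n) 0ℓ} → Decidable Q → ℕ
  #neighbours w Q? = count ((λ x → adjacent? E x w) ∩? Q?)

  #edgesAt : Fin n → {Q : Pred (Fin n) 0ℓ} → Decidable Q → ℕ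
  #edgesAt w Q? = count (incident? E w ∩? (Q? ∘ opposite w ∘ E))

  nLeafNbrs≡#neighbours : ∀ w → nLeafNbrs E w ≡ #neighbours w leaf?
  nLeafNbrs≡#neighbours w = length-filter-allFin ((λ x → adjacent? E x w) ∩? leaf?)

  nInnerNbrs≡#neighbours : ∀ w → nInnerNbrs E w ≡ #neighbours w (∁? leaf?)
  nInnerNbrs≡#neighbours w = length-filter-allFin ((λ x → adjacent? E x w) ∩? ∁? leaf?)

  #neighbours≤#edgesAt : ∀ w {Q} (Q? : Decidable Q) → #neighbours w Q? ≤ #edgesAt w Q?
  #neighbours≤#edgesAt w {Q} Q? =
    count-≤-injection ((λ x → adjacent? E x w) ∩? Q?) (incident? E w ∩? (Q? ∘ opposite w ∘ E))
      (proj₁ ∘ proj₁)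
      (λ { ((e , j) , q) → joins⇒incident (swap j) , subst Q (sym (opposite-≡ j)) q })
      (λ { ((e , j) , _) ((_ , j′) , _) refl → trans (sym (opposite-≡ j)) (opposite-≡ j′) })

  #edgesAt≤#neighbours : Simple E → ∀ w {Q} (Q? : Decidable Q) → #edgesAt w Q? ≤ #neighbours w Q?
  #edgesAt≤#neighbours (_ , no-parallel) w Q? =
    count-≤-injection (incident? E w ∩? (Q? ∘ opposite w ∘ E)) ((λ x → adjacent? E x w) ∩? Q?)
      (λ {e} _ → opposite w (E e))
      (λ { {e} (w∈e , q) → (e , incident⇒joins-opposite w∈e) , q })
      (λ { {e} {e′} (w∈e , _) (w∈e′ , _) eq → no-parallel e e′
             (joins-sameEnds (incident⇒joins-opposite w∈e)
                             (subst (λ o → Joins e′ o w) (sym eq) (incident⇒joins-opposite w∈e′))) })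

  #edgesAt≡#neighbours : Simple E → ∀ w {Q} (Q? : Decidable Q) → #edgesAt w Q? ≡ #neighbours w Q?
  #edgesAt≡#neighbours simple w Q? =
    ≤-antisym (#edgesAt≤#neighbours simple w Q?) (#neighbours≤#edgesAt w Q?)

  deg≡nLeafNbrs+nInnerNbrs : Simple E → ∀ w → deg E w ≡ nLeafNbrs E w + nInnerNbrs E w
  deg≡nLeafNbrs+nInnerNbrs simple w = begin
    deg E w                                         ≡⟨ deg≡count w ⟩
    count (incident? E w)                           ≡⟨ count-split (incident? E w) (leaf? ∘ opposite w ∘ E) ⟩
    #edgesAt w leaf? + #edgesAt w (∁? leaf?)        ≡⟨ cong₂ _+_ (#edgesAt≡#neighbours simple w leaf?)
                                                                  (#edgesAt≡#neighbours simple w (∁? leaf?)) ⟩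
    #neighbours w leaf? + #neighbours w (∁? leaf?)  ≡⟨ cong₂ _+_ (nLeafNbrs≡#neighbours w)
                                                                  (nInnerNbrs≡#neighbours w) ⟨
    nLeafNbrs E w + nInnerNbrs E w                  ∎
    where open ≡-Reasoning

  pure-avoids-leaf : ∀ {F x e} → IsPure E F → IsLeaf E x → e ∈ F → ¬ Incident E x e
  pure-avoids-leaf {F} {x} {e} pure leaf e∈F x∈e =
    count≡0⇒∁ ((_∈? F) ∩? incident? E x)
      (trans (sym (degIn≡count F x)) (2*d<1⇒d≡0 (subst (2 * degIn E F x <_) leaf (pure x))))
      e (e∈F , x∈e)

  degIn≤nInnerNbrs : Simple E → ∀ {F} → IsPure E F → ∀ w → degIn E F w ≤ nInnerNbrs E w
  degIn≤nInnerNbrs simple {F} pure w = begin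
    degIn E F w                       ≡⟨ degIn≡count F w ⟩
    count ((_∈? F) ∩? incident? E w)  ≤⟨ count-mono ((_∈? F) ∩? incident? E w)
                                                     (incident? E w ∩? (∁? leaf? ∘ opposite w ∘ E))
                                                     inner-end ⟩
    #edgesAt w (∁? leaf?)             ≡⟨ #edgesAt≡#neighbours simple w (∁? leaf?) ⟩
    #neighbours w (∁? leaf?)          ≡⟨ nInnerNbrs≡#neighbours w ⟨
    nInnerNbrs E w                    ∎
    where
    open ≤-Reasoning
    inner-end : ∀ {e} → e ∈ F × Incident E w e → Incident E w e × ¬ IsLeaf E (opposite w (E e))
    inner-end (e∈F , w∈e) =
      w∈e , λ leaf → pure-avoids-leaf {F} pure leaf e∈F (joins⇒incident (incident⇒joins-opposite w∈e))

  pure-slack : Simple E → ∀ {F w} → IsPure E F → nLeafNbrs E w > nInnerNbrs E w + 1 →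
               2 + 2 * degIn E F w ≤ deg E w
  pure-slack simple {F} {w} pure many-leaves =
    subst (2 + 2 * degIn E F w ≤_) (sym (deg≡nLeafNbrs+nInnerNbrs simple w))
      (d≤i⇒i+1<l⇒2+2*d≤l+i (degIn≤nInnerNbrs simple pure w) many-leaves)

delV-punchIn : ∀ {k} (v : Fin (suc (suc k))) (u : Fin (suc k)) → delV v (punchIn v u) ≡ u
delV-punchIn v u with v ≟ punchIn v u
... | yes v≡u = contradiction (sym v≡u) (punchInᵢ≢i v u)
... | no _    = trans (punchOut-cong v refl) (punchOut-punchIn v)

delV-injective : ∀ {k} {v x y : Fin (suc (suc k))} → x ≢ v → y ≢ v → delV v x ≡ delV v y → x ≡ y
delV-injective {v = v} {x} {y} x≢v y≢v eq with v ≟ x | v ≟ y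
... | yes v≡x | _       = contradiction (sym v≡x) x≢v
... | no _    | yes v≡y = contradiction (sym v≡y) y≢v
... | no v≢x  | no v≢y  = punchOut-injective v≢x v≢y eq

∈-insertAt-punchIn : ∀ {m} (F : Subset m) (i : Fin (suc m)) (b : Bool) →
                     (λ j → punchIn i j ∈ insertAt F i b) ≐ (_∈ F)
∈-insertAt-punchIn F i b =
  (λ {j} j∈ → lookup⇒[]= j F (trans (sym (insertAt-punchIn F i b j)) ([]=⇒lookup j∈))) ,
  (λ {j} j∈ → lookup⇒[]= (punchIn i j) (insertAt F i b)
                 (trans (insertAt-punchIn F i b j) ([]=⇒lookup j∈)))

∉-insertAt-false : ∀ {m} (F : Subset m) (i : Fin (suc m)) → ¬ (i ∈ insertAt F i false)
∉-insertAt-false F i i∈ with () ← trans (sym (insertAt-lookup F i false)) ([]=⇒lookup i∈)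

module Deletion {k m} (E : EdgeMap (suc (suc k)) (suc m)) (simple : Simple E)
                {v w : Fin (suc (suc k))} {e₀ : Fin (suc m)}
                (v-leaf : IsLeaf E v) (e₀-joins : Joins E e₀ v w) where

  E′ : EdgeMap (suc k) m
  E′ = delLeaf E v e₀

  insert₀ : Subset m → Subset (suc m)
  insert₀ F = insertAt F e₀ false

  w≢v : w ≢ v
  w≢v = joins⇒≢ E simple e₀-joins ∘ sym

  v∈e₀ : Incident E v e₀
  v∈e₀ = joins⇒incident E e₀-joins

  w∈e₀ : Incident E w e₀
  w∈e₀ = joins⇒incident E (swap e₀-joins)

  e₀-only-edge-at-v : ∀ i → ¬ Incident E v (punchIn e₀ i)
  e₀-only-edge-at-v = count≡0⇒∁ (incident? E v ∘ punchIn e₀) (suc-injective (begin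
    1 + count (incident? E v ∘ punchIn e₀)
      ≡⟨ cong (_+ count (incident? E v ∘ punchIn e₀)) (indicator-yes (incident? E v e₀) v∈e₀) ⟨
    indicator (incident? E v e₀) + count (incident? E v ∘ punchIn e₀)  ≡⟨ count-punchIn (incident? E v) e₀ ⟨
    count (incident? E v)                                              ≡⟨ deg≡count E v ⟨
    deg E v                                                            ≡⟨ v-leaf ⟩
    1                                                                  ∎))
    where open ≡-Reasoning

  incident-delLeaf : ∀ {u} → u ≢ v → (λ i → Incident E u (punchIn e₀ i)) ≐ Incident E′ (delV v u)
  incident-delLeaf u≢v =
    (λ { (inj₁ eq) → inj₁ (cong (delV v) eq) ; (inj₂ eq) → inj₂ (cong (delV v) eq) }) ,
    (λ { {i} (inj₁ eq) → inj₁ (delV-injective u≢v (e₀-only-edge-at-v i ∘ inj₁ ∘ sym) eq)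
       ; {i} (inj₂ eq) → inj₂ (delV-injective u≢v (e₀-only-edge-at-v i ∘ inj₂ ∘ sym) eq) })

  deg-delLeaf : ∀ {u} → u ≢ v → deg E u ≡ indicator (incident? E u e₀) + deg E′ (delV v u)
  deg-delLeaf {u} u≢v = begin
    deg E u                                                            ≡⟨ deg≡count E u ⟩
    count (incident? E u)                                              ≡⟨ count-punchIn (incident? E u) e₀ ⟩
    indicator (incident? E u e₀) + count (incident? E u ∘ punchIn e₀)
      ≡⟨ cong (indicator (incident? E u e₀) +_)
              (count-cong (incident? E u ∘ punchIn e₀) (incident? E′ (delV v u)) (incident-delLeaf u≢v)) ⟩
    indicator (incident? E u e₀) + count (incident? E′ (delV v u))
      ≡⟨ cong (indicator (incident? E u e₀) +_) (deg≡count E′ (delV v u)) ⟨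
    indicator (incident? E u e₀) + deg E′ (delV v u)                   ∎
    where open ≡-Reasoning

  deg-delLeaf-w : deg E w ≡ suc (deg E′ (delV v w))
  deg-delLeaf-w =
    trans (deg-delLeaf w≢v) (cong (_+ deg E′ (delV v w)) (indicator-yes (incident? E w e₀) w∈e₀))

  deg-delLeaf-other : ∀ {u} → u ≢ v → u ≢ w → deg E u ≡ deg E′ (delV v u)
  deg-delLeaf-other {u} u≢v u≢w = trans (deg-delLeaf u≢v) (cong (_+ deg E′ (delV v u))
    (indicator-no (incident? E u e₀) ([ u≢v , u≢w ] ∘ joins-incident E e₀-joins)))

  degIn-insert₀ : ∀ F u → degIn E (insert₀ F) u ≡ count ((_∈? F) ∩? (incident? E u ∘ punchIn e₀))
  degIn-insert₀ F u = begin
    degIn E (insert₀ F) u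
      ≡⟨ degIn≡count E (insert₀ F) u ⟩
    count F₀-edgesAt-u
      ≡⟨ count-punchIn F₀-edgesAt-u e₀ ⟩
    indicator (F₀-edgesAt-u e₀) + count (F₀-edgesAt-u ∘ punchIn e₀)
      ≡⟨ cong₂ _+_ (indicator-no (F₀-edgesAt-u e₀) (∉-insertAt-false F e₀ ∘ proj₁))
                   (count-cong (F₀-edgesAt-u ∘ punchIn e₀) ((_∈? F) ∩? (incident? E u ∘ punchIn e₀))
                      ((λ (i∈ , u∈) → ⊆F i∈ , u∈) , (λ (i∈ , u∈) → F⊆ i∈ , u∈))) ⟩
    count ((_∈? F) ∩? (incident? E u ∘ punchIn e₀))  ∎
    where
    open ≡-Reasoning
    F₀-edgesAt-u = (_∈? insert₀ F) ∩? incident? E u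
    ⊆F = proj₁ (∈-insertAt-punchIn F e₀ false)
    F⊆ = proj₂ (∈-insertAt-punchIn F e₀ false)

  degIn-delLeaf : ∀ F {u} → u ≢ v → degIn E (insert₀ F) u ≡ degIn E′ F (delV v u)
  degIn-delLeaf F {u} u≢v = begin
    degIn E (insert₀ F) u                        ≡⟨ degIn-insert₀ F u ⟩
    count ((_∈? F) ∩? (incident? E u ∘ punchIn e₀))
      ≡⟨ count-cong ((_∈? F) ∩? (incident? E u ∘ punchIn e₀)) ((_∈? F) ∩? incident? E′ (delV v u))
                    ((λ (i∈ , u∈) → i∈ , to u∈) , (λ (i∈ , u∈) → i∈ , from u∈)) ⟩
    count ((_∈? F) ∩? incident? E′ (delV v u))   ≡⟨ degIn≡count E′ F (delV v u) ⟨
    degIn E′ F (delV v u)                        ∎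
    where
    open ≡-Reasoning
    to = proj₁ (incident-delLeaf u≢v)
    from = proj₂ (incident-delLeaf u≢v)

  degIn-v : ∀ F → degIn E (insert₀ F) v ≡ 0
  degIn-v F = trans (degIn-insert₀ F v)
    (count-none ((_∈? F) ∩? (incident? E v ∘ punchIn e₀)) (λ i → e₀-only-edge-at-v i ∘ proj₂))

  pure-avoids-e₀ : ∀ F → IsPure E F → lookup F e₀ ≡ false
  pure-avoids-e₀ F pure with lookup F e₀ in eq
  ... | true  = contradiction v∈e₀ (pure-avoids-leaf E {F} pure v-leaf (lookup⇒[]= e₀ F eq))
  ... | false = refl

  insert₀-pure⇒pure : nLeafNbrs E w > nInnerNbrs E w + 1 → ∀ {F} → IsPure E (insert₀ F) → IsPure E′ F
  insert₀-pure⇒pure many-leaves {F} pure u′ =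
    subst (λ x → 2 * degIn E′ F x < deg E′ x) (delV-punchIn v u′) (at (punchIn v u′) (punchInᵢ≢i v u′))
    where
    at : ∀ u → u ≢ v → 2 * degIn E′ F (delV v u) < deg E′ (delV v u)
    at u u≢v with u ≟ w
    ... | yes refl = s≤s⁻¹ (subst₂ (λ d D → 2 + 2 * d ≤ D) (degIn-delLeaf F u≢v) deg-delLeaf-w
                                   (pure-slack E simple {insert₀ F} pure many-leaves))
    ... | no u≢w   = subst₂ (λ d D → 2 * d < D) (degIn-delLeaf F u≢v) (deg-delLeaf-other u≢v u≢w) (pure u)

  pure⇒insert₀-pure : ∀ {F} → IsPure E′ F → IsPure E (insert₀ F)
  pure⇒insert₀-pure {F} pure u with u ≟ v
  ... | yes refl = subst₂ (λ d D → 2 * d < D) (sym (degIn-v F)) (sym v-leaf) (s≤s z≤n)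
  ... | no u≢v with u ≟ w
  ...   | yes refl = subst₂ (λ d D → 2 * d < D) (sym (degIn-delLeaf F u≢v)) (sym deg-delLeaf-w)
                            (m<n⇒m<1+n (pure (delV v u)))
  ...   | no u≢w   = subst₂ (λ d D → 2 * d < D) (sym (degIn-delLeaf F u≢v))
                            (sym (deg-delLeaf-other u≢v u≢w)) (pure (delV v u))

lemma16 : ∀ {k m} (E : EdgeMap (suc (suc k)) (suc m)) → IsTree E
          → (v w : Fin (suc (suc k))) (e₀ : Fin (suc m))
          → IsLeaf E v → (E e₀ ≡ (v , w) ⊎ E e₀ ≡ (w , v))
          → nLeafNbrs E w > nInnerNbrs E w + 1
          → numPure E ≡ numPure (delLeaf E v e₀)
lemma16 {m = m} E (simple , _ , _) v w e₀ v-leaf e₀-joins many-leaves = begin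
  numPure E
    ≡⟨ length-filter-allSubsets-insertAt (isPure? E) e₀ pure-avoids-e₀ ⟩
  length (filter (isPure? E ∘ insert₀) (allSubsets m))
    ≡⟨ cong length (filter-≐ (isPure? E ∘ insert₀) (isPure? E′)
                     (insert₀-pure⇒pure many-leaves , pure⇒insert₀-pure) (allSubsets m)) ⟩
  numPure E′ ∎
  where
  open Deletion E simple v-leaf e₀-joins
  open ≡-Reasoning
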